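{- The theory $\mathbf{T}$ is not closed generic. In fact, no theory $\mathbf{T}^+$ with $\mathbf{T}^+\supseteq\mathbf{T}$ is closed generic.
   Context: Fix a nonempty set of symbols called propositional atoms and a symbol $\mathrm{K}$ which is not a propositional atom. Formulas are defined recursively: every propositional atom is a formula; if $\varphi,\psi$ are formulas then so are $\neg\varphi$, $(\varphi\wedge\psi)$, $(\varphi\vee\psi)$, $(\varphi\rightarrow\psi)$; if $\varphi$ is a formula then so is $\mathrm{K}(\varphi)$. A formula is basic if it is a propositional atom or of the form $\mathrm{K}\varphi$. A theory is a set of formulas. A model is a function assigning a truth value to every basic formula; truth $\mathscr M\models\varphi$ of an arbitrary formula is defined from the values of basic formulas by the classical truth tables (formulas $\mathrm{K}\varphi$ are treated like atoms). $\mathscr M\models T$ means $\mathscr M\models\varphi$ for all $\varphi\in T$; $T\models\varphi$ means every model of $T$ satisfies $\varphi$. A theory $T$ is closed if $\varphi\in T$ implies $\mathrm{K}\varphi\in T$. $\mathbf{T}$ is the set of all formulas of the form $\mathrm{K}\varphi\rightarrow\varphi$. For a theory $T$ and a set $S$ of propositional atoms, $\mathscr M_{T,S}$ is the model with $\mathscr M_{T,S}\models p$ iff $p\in S$ for atoms $p$, and $\mathscr M_{T,S}\models\mathrm{K}\varphi$ iff $T\models\varphi$. A theory $T$ is closed generic if for every set $S$ of propositional atoms and every closed theory $T'\supseteq T$, $\mathscr M_{T',S}\models T$. -}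

module Defs where

open import Data.Bool using (Bool; true; false; not; _∧_; _∨_)
open import Data.Product using (_×_; Σ)
open import Relation.Binary.PropositionalEquality using (_≡_)
open import Function.Bundles using (_⇔_)

-- Formulas over a type `At` of propositional atoms; `K` is the knowledge operator.
data Form (At : Set) : Set where
  atom : At → Form At
  ¬'_  : Form At → Form At
  _∧'_ : Form At → Form At → Form At
  _∨'_ : Form At → Form At → Form At
  _⇒'_ : Form At → Form At → Form At
  K    : Form At → Form At

module _ {At : Set} where

  -- A model assigns a truth value to every basic formula:
  -- to atoms (first component) and to formulas K φ (second component, value at φ).
  record Model : Set where
    constructor model
    field
      atomVal : At → Bool
      kVal    : Form At → Bool
  open Model public

  eval : Model → Form At → Bool
  eval M (atom p) = atomVal M p
  eval M (¬' φ)   = not (eval M φ)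
  eval M (φ ∧' ψ) = eval M φ ∧ eval M ψ
  eval M (φ ∨' ψ) = eval M φ ∨ eval M ψ
  eval M (φ ⇒' ψ) = not (eval M φ) ∨ eval M ψ
  eval M (K φ)    = kVal M φ

  _⊨_ : Model → Form At → Set
  M ⊨ φ = eval M φ ≡ true

  Theory : Set₁
  Theory = Form At → Set

  _⊨T_ : Model → Theory → Set
  M ⊨T T = ∀ φ → T φ → M ⊨ φ

  _⊩_ : Theory → Form At → Set
  T ⊩ φ = ∀ (M : Model) → M ⊨T T → M ⊨ φ

  _⊆_ : Theory → Theory → Set
  T ⊆ T' = ∀ φ → T φ → T' φ

  Closed : Theory → Set
  Closed T = ∀ φ → T φ → T (K φ)

  𝐓 : Theory
  𝐓 ψ = Σ (Form At) (λ φ → ψ ≡ (K φ ⇒' φ))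

  IsM : Theory → (At → Set) → Model → Set
  IsM T S M = (∀ p → (M ⊨ atom p) ⇔ S p) × (∀ φ → (M ⊨ K φ) ⇔ (T ⊩ φ))

  ClosedGeneric : Theory → Set₁
  ClosedGeneric T =
    ∀ (S : At → Set) (T' : Theory) → Closed T' → T ⊆ T' →
    ∀ (M : Model) → IsM T' S M → M ⊨T T

{-# OPTIONS --safe #-}
module Submission where

-- The theory of all formulas is closed and inconsistent, hence entails everything.
-- So 𝓜_{T',∅} for this T' makes every K φ true and every atom false, and thus
-- refutes K p → p, which belongs to any T⁺ ⊇ 𝐓.

open import Defs
open import Relation.Nullary using (¬_)
open import Data.Product using (_×_; _,_)
open import Data.Bool using (true; false)
open import Data.Empty using (⊥; ⊥-elim)
open import Data.Unit using (⊤; tt)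
open import Relation.Binary.PropositionalEquality using (refl)
open import Function.Bundles using (mk⇔)

module _ {At : Set} where

  allFormulas : Theory {At}
  allFormulas _ = ⊤

  allFormulas-closed : Closed allFormulas
  allFormulas-closed _ _ = tt

  ⊆-allFormulas : ∀ (T : Theory {At}) → T ⊆ allFormulas
  ⊆-allFormulas _ _ _ = tt

  ⊩-explosion : ∀ {T : Theory {At}} {ψ} → T ψ → T (¬' ψ) → ∀ φ → T ⊩ φ
  ⊩-explosion {ψ = ψ} Tψ T¬ψ φ M M⊨T with eval M ψ | M⊨T ψ Tψ | M⊨T (¬' ψ) T¬ψ
  ... | true | _ | ()

  omniscientModel : Model {At}
  omniscientModel = model (λ _ → false) (λ _ → true)

  omniscientModel-isM : At → IsM allFormulas (λ _ → ⊥) omniscientModel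
  omniscientModel-isM p =
    (λ _ → mk⇔ (λ ()) ⊥-elim) ,
    (λ φ → mk⇔ (λ _ → ⊩-explosion {ψ = atom p} tt tt φ) (λ _ → refl))

  ⊇𝐓⇒¬ClosedGeneric : At → ∀ (T⁺ : Theory {At}) → 𝐓 ⊆ T⁺ → ¬ ClosedGeneric T⁺
  ⊇𝐓⇒¬ClosedGeneric p T⁺ 𝐓⊆T⁺ cg
    with cg (λ _ → ⊥) allFormulas allFormulas-closed (⊆-allFormulas T⁺)
            omniscientModel (omniscientModel-isM p)
            (K (atom p) ⇒' atom p) (𝐓⊆T⁺ _ (atom p , refl))
  ... | ()

theorem27 : (At : Set) → At →
    (¬ ClosedGeneric {At} 𝐓) × (∀ (T⁺ : Theory {At}) → 𝐓 ⊆ T⁺ → ¬ ClosedGeneric T⁺)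
theorem27 At p = ⊇𝐓⇒¬ClosedGeneric p 𝐓 (λ _ h → h) , ⊇𝐓⇒¬ClosedGeneric p
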